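{- If the orbit is divisor-mixing on the dyadic scale $N$, then \[ \frac{1}{V(N)}\sum_{j_+(N)\le j<j_-(N)}\tau(n_j)\asymp\log N. \]
   Context: $\tau(n)$ is the number of positive divisors of $n$. Fix $x$ and the orbit $n_0=x$, $n_{j+1}=n_j-\tau(n_j)$. For $N\ge1$ let $j_+(N):=\min\{j:n_j\le2N\}$, $j_-(N):=\min\{j:n_j\le N\}$, $V(N):=j_-(N)-j_+(N)$. Asymptotic notation refers to $N\to\infty$. The orbit is divisor-mixing on the scale $N$ if \[ \sum_{d\le\sqrt{2N}}\left|\#\{j_+(N)\le j<j_-(N):d\mid n_j\}-\frac{V(N)}{d}\right|=o\bigl(V(N)\log N\bigr). \] -}

module Defs where

open import Data.Nat using (ℕ; zero; suc; _+_; _*_; _∸_; _≤_; _≤ᵇ_)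
open import Data.Nat.Divisibility using (_∣?_)
import Data.Nat.ListAction
open import Data.Bool using (Bool; true; false; if_then_else_)
open import Data.List using (List; []; _∷_; length; filter; map; upTo)
open import Relation.Nullary.Decidable using (does)
open import Data.Integer using () renaming (+_ to ⁺_)
open import Data.Rational as ℚ using (ℚ)

range : ℕ → ℕ → List ℕ
range a b = map (λ i → a + i) (upTo (b ∸ a))

-- τ n = number of positive divisors of n, i.e. #{1 ≤ d ≤ n : d ∣ n}.
-- (Convention: τ 0 = 0; this value is never used inside the window.)
τ : ℕ → ℕ
τ n = length (filter (λ d → d ∣? n) (range 1 (suc n)))

orbit : ℕ → ℕ → ℕ
orbit x zero    = x
orbit x (suc j) = orbit x j ∸ τ (orbit x j)

search : (ℕ → Bool) → ℕ → ℕ → ℕ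
search p s zero    = s
search p s (suc k) = if p s then s else search p (suc s) k

-- least j ≤ x with n_j ≤ M.  Since n_j strictly decreases while
-- positive, n_x = 0 ≤ M, so this is the true minimum min{j : n_j ≤ M}.
firstBelow : ℕ → ℕ → ℕ
firstBelow x M = search (λ j → orbit x j ≤ᵇ M) 0 x

jPlus : ℕ → ℕ → ℕ
jPlus x N = firstBelow x (2 * N)

jMinus : ℕ → ℕ → ℕ
jMinus x N = firstBelow x N

V : ℕ → ℕ → ℕ
V x N = jMinus x N ∸ jPlus x N

window : ℕ → ℕ → List ℕ
window x N = range (jPlus x N) (jMinus x N)

countDiv : ℕ → ℕ → ℕ → ℕ
countDiv x N d = length (filter (λ j → d ∣? orbit x j) (window x N))

tauSum : ℕ → ℕ → ℕ
tauSum x N = Data.Nat.ListAction.sum (map (λ j → τ (orbit x j)) (window x N))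

-- the divisors d = e+1 with 1 ≤ d ≤ √(2N), i.e. d*d ≤ 2N
-- (listed as e = d - 1, e ∈ [0, 2N))
smallDivMinus1 : ℕ → List ℕ
smallDivMinus1 N = filter (λ e → suc e * suc e Data.Nat.≤? 2 * N) (upTo (2 * N))

mixingError : ℕ → ℕ → ℚ
mixingError x N =
  Data.List.foldr ℚ._+_ ℚ.0ℚ
    (map (λ e → ℚ.∣ (⁺ countDiv x N (suc e)) ℚ./ 1 ℚ.- (⁺ V x N) ℚ./ suc e ∣)
         (smallDivMinus1 N))

-- For N < n ≤ 2N every divisor d of n is paired with n/d, and one of the two is at most
-- √(2N).  Hence the number S(n) of divisors d ≤ √(2N) of n satisfies S(n) ≤ τ(n) ≤ 2 S(n),
-- and summing over the window (where N < n_j ≤ 2N) and exchanging the order of summation,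
-- Σ_j τ(n_j) lies between A and 2A for A = Σ_{d ≤ √(2N)} #{j : d ∣ n_j}.  Divisor-mixing says
-- that A differs from Σ_{d ≤ √(2N)} V/d by o(V log N), and comparing the harmonic sum with its
-- dyadic blocks, (m + 2)/2 ≤ H(2^m) ≤ m + 1, puts Σ_{d ≤ √(2N)} V/d between V log₂ N / 4 and
-- 4 V log₂ N.  The mixing hypothesis for k = 7 and k = 0 absorbs the error terms.
module Submission where

open import Level using (0ℓ)
open import Algebra.Bundles using (CommutativeSemigroup)
open import Algebra.Core using (Op₂)
open import Algebra.Structures using (IsCommutativeMonoid)
open import Data.Empty using (⊥-elim)
open import Data.List using (List; []; _∷_; _++_; [_]; map; filter; foldr; upTo)
open import Data.List.Properties using (upTo-∷ʳ; map-++)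
open import Data.Nat as ℕ using (ℕ; zero; suc; _+_; _*_; _≤_; _<_; z≤n; s≤s)
import Data.Nat.Properties as ℕ
import Data.Rational.Properties as ℚ
open import Data.Product using (_×_; _,_; proj₁; proj₂)
open import Function using (_∘′_)
open import Relation.Binary.Core using (Rel; _Preserves₂_⟶_⟶_)
open import Relation.Binary.PropositionalEquality
  using (_≡_; refl; sym; trans; cong; cong₂; subst; subst₂; module ≡-Reasoning)
open import Relation.Binary.Structures using (IsPreorder)
open import Relation.Nullary using (Dec; yes; no; ¬_)
open import Relation.Unary using (Pred; Decidable)

module FiniteSum
  {A : Set} {_∙_ : Op₂ A} {ε : A} (isCommutativeMonoid : IsCommutativeMonoid _≡_ _∙_ ε)
  {_≤_ : Rel A 0ℓ} (isPreorder : IsPreorder _≡_ _≤_) (∙-mono-≤ : _∙_ Preserves₂ _≤_ ⟶ _≤_ ⟶ _≤_)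
  where

  open IsCommutativeMonoid isCommutativeMonoid
    using (assoc; identityˡ; identityʳ; isCommutativeSemigroup)
  open IsPreorder isPreorder using (reflexive) renaming (refl to ≤-refl; trans to ≤-trans)
  open ≡-Reasoning

  private
    commutativeSemigroup : CommutativeSemigroup 0ℓ 0ℓ
    commutativeSemigroup = record { isCommutativeSemigroup = isCommutativeSemigroup }

  open import Algebra.Properties.CommutativeSemigroup commutativeSemigroup using (interchange)

  private variable
    f g : ℕ → A
    m n : ℕ

  ∑< : ℕ → (ℕ → A) → A
  ∑< zero    f = ε
  ∑< (suc n) f = ∑< n f ∙ f n

  infix 5 ∑<
  syntax ∑< n (λ i → x) = ∑[ i < n ] x

  when : {P : Set} → Dec P → A → A
  when (yes _) x = x
  when (no _)  _ = ε

  when-true : ∀ {P : Set} (P? : Dec P) {x} → P → when P? x ≡ x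
  when-true (yes _) p = refl
  when-true (no ¬p) p = ⊥-elim (¬p p)

  when-false : ∀ {P : Set} (P? : Dec P) {x} → ¬ P → when P? x ≡ ε
  when-false (yes p) ¬p = ⊥-elim (¬p p)
  when-false (no _)  ¬p = refl

  when-∙ : ∀ {P : Set} (P? : Dec P) x y → when P? (x ∙ y) ≡ when P? x ∙ when P? y
  when-∙ (yes _) x y = refl
  when-∙ (no _)  x y = sym (identityˡ ε)

  when-≤ : ∀ {P : Set} (P? : Dec P) {x} → ε ≤ x → when P? x ≤ x
  when-≤ (yes _) 0≤x = ≤-refl
  when-≤ (no _)  0≤x = 0≤x

  when-nonNeg : ∀ {P : Set} (P? : Dec P) {x} → ε ≤ x → ε ≤ when P? x
  when-nonNeg (yes _) 0≤x = 0≤x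
  when-nonNeg (no _)  0≤x = ≤-refl

  when-mono-≤ : ∀ {P : Set} (P? : Dec P) {x y} → x ≤ y → when P? x ≤ when P? y
  when-mono-≤ (yes _) x≤y = x≤y
  when-mono-≤ (no _)  x≤y = ≤-refl

  ∑-cong : ∀ n → (∀ {i} → i < n → f i ≡ g i) → ∑< n f ≡ ∑< n g
  ∑-cong zero    f≡g = refl
  ∑-cong (suc n) f≡g = cong₂ _∙_ (∑-cong n (f≡g ∘′ ℕ.m≤n⇒m≤1+n)) (f≡g ℕ.≤-refl)

  ∑-ε : ∀ n → (∀ {i} → i < n → f i ≡ ε) → ∑< n f ≡ ε
  ∑-ε zero    f≡ε = refl
  ∑-ε (suc n) f≡ε = trans (cong₂ _∙_ (∑-ε n (f≡ε ∘′ ℕ.m≤n⇒m≤1+n)) (f≡ε ℕ.≤-refl)) (identityˡ ε)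

  ∑-distrib-∙ : ∀ (f g : ℕ → A) n → ∑[ i < n ] f i ∙ g i ≡ ∑< n f ∙ ∑< n g
  ∑-distrib-∙ f g zero    = sym (identityˡ ε)
  ∑-distrib-∙ f g (suc n) = begin
    (∑[ i < n ] f i ∙ g i) ∙ (f n ∙ g n)  ≡⟨ cong (_∙ (f n ∙ g n)) (∑-distrib-∙ f g n) ⟩
    (∑< n f ∙ ∑< n g) ∙ (f n ∙ g n)       ≡⟨ interchange (∑< n f) (∑< n g) (f n) (g n) ⟩
    (∑< n f ∙ f n) ∙ (∑< n g ∙ g n)       ∎

  ∑-split : ∀ (f : ℕ → A) m n → ∑< (m + n) f ≡ ∑< m f ∙ (∑[ i < n ] f (m + i))
  ∑-split f m zero    = trans (cong (λ k → ∑< k f) (ℕ.+-identityʳ m)) (sym (identityʳ (∑< m f)))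
  ∑-split f m (suc n) = begin
    ∑< (m + suc n) f                                ≡⟨ cong (λ k → ∑< k f) (ℕ.+-suc m n) ⟩
    ∑< (m + n) f ∙ f (m + n)                        ≡⟨ cong (_∙ f (m + n)) (∑-split f m n) ⟩
    (∑< m f ∙ (∑[ i < n ] f (m + i))) ∙ f (m + n)   ≡⟨ assoc _ _ _ ⟩
    ∑< m f ∙ ((∑[ i < n ] f (m + i)) ∙ f (m + n))   ∎

  ∑-comm : ∀ (F : ℕ → ℕ → A) m n → ∑[ i < m ] ∑[ j < n ] F i j ≡ ∑[ j < n ] ∑[ i < m ] F i j
  ∑-comm F zero    n = sym (∑-ε n (λ _ → refl))
  ∑-comm F (suc m) n = begin
    (∑[ i < m ] ∑[ j < n ] F i j) ∙ (∑[ j < n ] F m j)  ≡⟨ cong (_∙ ∑< n (F m)) (∑-comm F m n) ⟩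
    (∑[ j < n ] ∑[ i < m ] F i j) ∙ (∑[ j < n ] F m j)  ≡⟨ ∑-distrib-∙ (λ j → ∑[ i < m ] F i j) (F m) n ⟨
    ∑[ j < n ] (∑[ i < m ] F i j) ∙ F m j               ∎

  when-∑ : ∀ {P : Set} (P? : Dec P) (f : ℕ → A) n → when P? (∑< n f) ≡ ∑[ i < n ] when P? (f i)
  when-∑ (yes _) f n = refl
  when-∑ (no _)  f n = sym (∑-ε n (λ _ → refl))

  ∑-mono-≤ : ∀ n → (∀ {i} → i < n → f i ≤ g i) → ∑< n f ≤ ∑< n g
  ∑-mono-≤ zero    f≤g = ≤-refl
  ∑-mono-≤ (suc n) f≤g = ∙-mono-≤ (∑-mono-≤ n (f≤g ∘′ ℕ.m≤n⇒m≤1+n)) (f≤g ℕ.≤-refl)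

  ∑-nonNeg : ∀ n → (∀ i → ε ≤ f i) → ε ≤ ∑< n f
  ∑-nonNeg zero    0≤f = ≤-refl
  ∑-nonNeg (suc n) 0≤f = ≤-trans (reflexive (sym (identityˡ ε))) (∙-mono-≤ (∑-nonNeg n 0≤f) (0≤f n))

  ∑-prefix-≤ : m ℕ.≤ n → (∀ i → ε ≤ f i) → ∑< m f ≤ ∑< n f
  ∑-prefix-≤ {m = m} {f = f} m≤n 0≤f with ℕ.m≤n⇒∃[o]m+o≡n m≤n
  ... | o , refl = ≤-trans (reflexive (sym (identityʳ (∑< m f))))
                           (≤-trans (∙-mono-≤ ≤-refl (∑-nonNeg o (λ i → 0≤f (m + i))))
                                    (reflexive (sym (∑-split f m o))))

  foldr-map-upTo : ∀ (f : ℕ → A) n → foldr _∙_ ε (map f (upTo n)) ≡ ∑< n f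
  foldr-map-upTo f zero    = refl
  foldr-map-upTo f (suc n) = begin
    foldr _∙_ ε (map f (upTo (suc n)))          ≡⟨ cong (foldr _∙_ ε ∘′ map f) (upTo-∷ʳ n) ⟨
    foldr _∙_ ε (map f (upTo n ++ [ n ]))       ≡⟨ cong (foldr _∙_ ε) (map-++ f (upTo n) [ n ]) ⟩
    foldr _∙_ ε (map f (upTo n) ++ [ f n ])     ≡⟨ foldr-∷ʳ (map f (upTo n)) (f n) ⟩
    foldr _∙_ ε (map f (upTo n)) ∙ f n          ≡⟨ cong (_∙ f n) (foldr-map-upTo f n) ⟩
    ∑< n f ∙ f n                                ∎
    where
    foldr-∷ʳ : ∀ xs y → foldr _∙_ ε (xs ++ [ y ]) ≡ foldr _∙_ ε xs ∙ y
    foldr-∷ʳ []       y = trans (identityʳ y) (sym (identityˡ y))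
    foldr-∷ʳ (x ∷ xs) y = trans (cong (x ∙_) (foldr-∷ʳ xs y)) (sym (assoc x _ y))

  foldr-map-filter : ∀ {B : Set} {P : Pred B 0ℓ} (P? : Decidable P) (f : B → A) xs →
    foldr _∙_ ε (map f (filter P? xs)) ≡ foldr _∙_ ε (map (λ x → when (P? x) (f x)) xs)
  foldr-map-filter P? f []       = refl
  foldr-map-filter P? f (x ∷ xs) with P? x
  ... | yes _ = cong (f x ∙_) (foldr-map-filter P? f xs)
  ... | no _  = trans (foldr-map-filter P? f xs) (sym (identityˡ _))

module ∑ℕ = FiniteSum ℕ.+-0-isCommutativeMonoid ℕ.≤-isPreorder ℕ.+-mono-≤
module ∑ℚ = FiniteSum ℚ.+-0-isCommutativeMonoid ℚ.≤-isPreorder ℚ.+-mono-≤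

module Counting where
  open ∑ℕ
  open import Data.List using (length)
  open import Data.List.Properties using (map-∘)
  open import Data.Nat using (_≟_)
  open import Data.Nat.ListAction using (sum)
  open import Data.Sum using (inj₁; inj₂)
  open import Function.Definitions using (Injective)

  𝟙 : {P : Set} → Dec P → ℕ
  𝟙 P? = when P? 1

  term-≤-∑ : ∀ (f : ℕ → ℕ) {i n} → i < n → f i ≤ ∑< n f
  term-≤-∑ f {i} {suc n} i<1+n with ℕ.m≤n⇒m<n∨m≡n (ℕ.≤-pred i<1+n)
  ... | inj₁ i<n  = ℕ.≤-trans (term-≤-∑ f i<n) (ℕ.m≤m+n _ (f n))
  ... | inj₂ refl = ℕ.m≤n+m (f i) _

  ∑-𝟙-≟-≤1 : ∀ {g : ℕ → ℕ} → Injective _≡_ _≡_ g → ∀ t n → ∑[ i < n ] 𝟙 (g i ≟ t) ≤ 1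
  ∑-𝟙-≟-≤1 {g} g-injective t zero    = z≤n
  ∑-𝟙-≟-≤1 {g} g-injective t (suc n) with g n ≟ t
  ... | no _     = ℕ.≤-trans (ℕ.≤-reflexive (ℕ.+-identityʳ _)) (∑-𝟙-≟-≤1 g-injective t n)
  ... | yes gn≡t = ℕ.≤-reflexive (cong (_+ 1) (∑-ε n earlier-miss))
    where
    earlier-miss : ∀ {i} → i < n → 𝟙 (g i ≟ t) ≡ 0
    earlier-miss {i} i<n with g i ≟ t
    ... | yes gi≡t = ⊥-elim (ℕ.<-irrefl (g-injective (trans gi≡t (sym gn≡t))) i<n)
    ... | no _     = refl

  length-filter-map-upTo : ∀ {P : Pred ℕ 0ℓ} (P? : Decidable P) (f : ℕ → ℕ) n →
    length (filter P? (map f (upTo n))) ≡ ∑[ i < n ] 𝟙 (P? (f i))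
  length-filter-map-upTo P? f n = begin
    length (filter P? (map f (upTo n)))                ≡⟨ length≡sum (filter P? (map f (upTo n))) ⟩
    sum (map (λ _ → 1) (filter P? (map f (upTo n))))   ≡⟨ foldr-map-filter P? (λ _ → 1) (map f (upTo n)) ⟩
    sum (map (λ x → 𝟙 (P? x)) (map f (upTo n)))        ≡⟨ cong sum (map-∘ (upTo n)) ⟨
    sum (map (λ i → 𝟙 (P? (f i))) (upTo n))            ≡⟨ foldr-map-upTo _ n ⟩
    ∑[ i < n ] 𝟙 (P? (f i))                            ∎
    where
    open ≡-Reasoning
    length≡sum : ∀ (xs : List ℕ) → length xs ≡ sum (map (λ _ → 1) xs)
    length≡sum []       = refl
    length≡sum (_ ∷ xs) = cong suc (length≡sum xs)

module SmallDivisors where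
  open ∑ℕ
  open Counting
  open import Data.Nat using (NonZero; _≟_; _≤?_)
  open import Data.Nat.Divisibility using (_∣?_; divides; ∣⇒≤; 1∣_)
  open import Defs using (τ)

  -- As in smallDivMinus1, an index i stands for the candidate divisor d = suc i.
  small? : ∀ M i → Dec (suc i * suc i ≤ M)
  small? M i = suc i * suc i ≤? M

  smallDivisorCount : ℕ → ℕ → ℕ
  smallDivisorCount M n = ∑[ i < M ] when (small? M i) (𝟙 (suc i ∣? n))

  τ≡∑ : ∀ n → τ n ≡ ∑[ i < n ] 𝟙 (suc i ∣? n)
  τ≡∑ n = length-filter-map-upTo (_∣? n) suc n

  0<τ : ∀ n .{{_ : NonZero n}} → 0 < τ n
  0<τ n@(suc _) = begin-strict
    0                            <⟨ ℕ.z<s ⟩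
    1                            ≡⟨ when-true (1 ∣? n) (1∣ n) ⟨
    𝟙 (1 ∣? n)                   ≤⟨ term-≤-∑ (λ i → 𝟙 (suc i ∣? n)) {n = n} ℕ.z<s ⟩
    ∑[ i < n ] 𝟙 (suc i ∣? n)    ≡⟨ τ≡∑ n ⟨
    τ n                          ∎
    where open ℕ.≤-Reasoning

  τ≡∑-up-to : ∀ {n M} .{{_ : NonZero n}} → n ≤ M → τ n ≡ ∑[ i < M ] 𝟙 (suc i ∣? n)
  τ≡∑-up-to {n} n≤M with ℕ.m≤n⇒∃[o]m+o≡n n≤M
  ... | k , refl = begin
    τ n                                                              ≡⟨ τ≡∑ n ⟩
    ∑[ i < n ] 𝟙 (suc i ∣? n)                                        ≡⟨ ℕ.+-identityʳ _ ⟨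
    (∑[ i < n ] 𝟙 (suc i ∣? n)) + 0                                  ≡⟨ cong (_ +_) (∑-ε k no-divisor) ⟨
    (∑[ i < n ] 𝟙 (suc i ∣? n)) + (∑[ i < k ] 𝟙 (suc (n + i) ∣? n))  ≡⟨ ∑-split _ n k ⟨
    ∑[ i < n + k ] 𝟙 (suc i ∣? n)                                    ∎
    where
    open ≡-Reasoning
    no-divisor : ∀ {i} → i < k → 𝟙 (suc (n + i) ∣? n) ≡ 0
    no-divisor {i} _ = when-false (suc (n + i) ∣? n) (λ d∣n → ℕ.<⇒≱ (s≤s (ℕ.m≤m+n n i)) (∣⇒≤ d∣n))

  cofactor-small : ∀ {a b M} → a * b ≤ M → ¬ (a * a ≤ M) → b * b ≤ M
  cofactor-small {a} {b} ab≤M a²≰M with a ≤? b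
  ... | yes a≤b = ⊥-elim (a²≰M (ℕ.≤-trans (ℕ.*-monoʳ-≤ a a≤b) ab≤M))
  ... | no  a≰b = ℕ.≤-trans (ℕ.*-monoˡ-≤ b (ℕ.<⇒≤ (ℕ.≰⇒> a≰b))) ab≤M

  smallDivisorCount≤τ : ∀ {n M} .{{_ : NonZero n}} → n ≤ M → smallDivisorCount M n ≤ τ n
  smallDivisorCount≤τ {n} {M} n≤M = ℕ.≤-trans
    (∑-mono-≤ M (λ {i} _ → when-≤ (small? M i) z≤n))
    (ℕ.≤-reflexive (sym (τ≡∑-up-to n≤M)))

  cofactor-unique : ∀ n M b → ∑[ i < M ] 𝟙 (suc i * suc b ≟ n) ≤ 𝟙 (suc b ∣? n)
  cofactor-unique n M b with suc b ∣? n
  ... | yes _  = ∑-𝟙-≟-≤1 (λ eq → ℕ.suc-injective (ℕ.*-cancelʳ-≡ _ _ (suc b) eq)) n M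
  ... | no b∤n = ℕ.≤-reflexive (∑-ε M (λ {i} _ →
                   when-false (suc i * suc b ≟ n) (b∤n ∘′ divides (suc i) ∘′ sym)))

  divisor-small-or-smallCofactor : ∀ {n M} .{{_ : NonZero n}} → n ≤ M → ∀ i →
    𝟙 (suc i ∣? n) ≤ when (small? M i) (𝟙 (suc i ∣? n))
                     + (∑[ b < M ] when (small? M b) (𝟙 (suc i * suc b ≟ n)))
  divisor-small-or-smallCofactor {n} {M} n≤M i with small? M i | suc i ∣? n
  ... | yes _   | _                      = ℕ.m≤m+n _ _
  ... | no _    | no _                   = z≤n
  ... | no _    | yes (divides zero n≡0) = ⊥-elim (ℕ.≢-nonZero⁻¹ n n≡0)
  ... | no i²≰M | yes (divides (suc b) n≡b*i) = begin
    1                      ≡⟨ when-true (small? M b) b-small ⟨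
    when (small? M b) 1    ≡⟨ cong (when (small? M b)) (when-true (suc i * suc b ≟ n) i*b≡n) ⟨
    pair b                 ≤⟨ term-≤-∑ pair b<M ⟩
    ∑[ b < M ] pair b      ∎
    where
    open ℕ.≤-Reasoning
    pair : ℕ → ℕ
    pair b = when (small? M b) (𝟙 (suc i * suc b ≟ n))
    i*b≡n : suc i * suc b ≡ n
    i*b≡n = trans (ℕ.*-comm (suc i) (suc b)) (sym n≡b*i)
    b<M : b < M
    b<M = ℕ.≤-trans (∣⇒≤ (divides (suc i) (sym i*b≡n))) n≤M
    b-small : suc b * suc b ≤ M
    b-small = cofactor-small {suc i} {suc b} (ℕ.≤-trans (ℕ.≤-reflexive i*b≡n) n≤M) i²≰M

  -- A divisor suc i of n that is not small has a small cofactor suc b (each small b being the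
  -- cofactor of at most one i), so n has at most as many non-small divisors as small ones.
  τ≤2*smallDivisorCount : ∀ {n M} .{{_ : NonZero n}} → n ≤ M →
                          τ n ≤ smallDivisorCount M n + smallDivisorCount M n
  τ≤2*smallDivisorCount {n} {M} n≤M = begin
    τ n
      ≡⟨ τ≡∑-up-to n≤M ⟩
    ∑[ i < M ] 𝟙 (suc i ∣? n)
      ≤⟨ ∑-mono-≤ M (λ {i} _ → divisor-small-or-smallCofactor n≤M i) ⟩
    ∑[ i < M ] when (small? M i) (𝟙 (suc i ∣? n)) + (∑[ b < M ] pair i b)
      ≡⟨ ∑-distrib-∙ _ _ M ⟩
    S + (∑[ i < M ] ∑[ b < M ] pair i b)
      ≡⟨ cong (S +_) (∑-comm pair M M) ⟩
    S + (∑[ b < M ] ∑[ i < M ] pair i b)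
      ≡⟨ cong (S +_) (∑-cong M (λ {b} _ → when-∑ (small? M b) (λ i → 𝟙 (suc i * suc b ≟ n)) M)) ⟨
    S + (∑[ b < M ] when (small? M b) (∑[ i < M ] 𝟙 (suc i * suc b ≟ n)))
      ≤⟨ ℕ.+-monoʳ-≤ S (∑-mono-≤ M (λ {b} _ → when-mono-≤ (small? M b) (cofactor-unique n M b))) ⟩
    S + S
      ∎
    where
    open ℕ.≤-Reasoning
    S : ℕ
    S = smallDivisorCount M n
    pair : ℕ → ℕ → ℕ
    pair i b = when (small? M b) (𝟙 (suc i * suc b ≟ n))

module Orbit where
  open SmallDivisors using (0<τ)
  open import Data.Bool using (true; false; T)
  open import Data.Nat using (pred; _∸_; _≤ᵇ_)
  open import Data.Sum using (_⊎_; inj₁; inj₂)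
  open import Data.Unit using (tt)
  open import Defs using (orbit; search; firstBelow; jPlus; jMinus; V)
  open ℕ.≤-Reasoning

  orbit-step-≤ : ∀ x j → orbit x (suc j) ≤ pred (orbit x j)
  orbit-step-≤ x j with orbit x j
  ... | zero  = z≤n
  ... | suc n = ℕ.∸-monoʳ-≤ (suc n) (0<τ (suc n))

  orbit-antitone : ∀ x {j k} → j ≤ k → orbit x k ≤ orbit x j
  orbit-antitone x {k = zero}  z≤n   = ℕ.≤-refl
  orbit-antitone x {j} {suc k} j≤1+k with ℕ.m≤n⇒m<n∨m≡n j≤1+k
  ... | inj₁ j<1+k = begin
    orbit x (suc k)   ≤⟨ orbit-step-≤ x k ⟩
    pred (orbit x k)  ≤⟨ ℕ.pred[n]≤n ⟩
    orbit x k         ≤⟨ orbit-antitone x (ℕ.≤-pred j<1+k) ⟩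
    orbit x j         ∎
  ... | inj₂ refl  = ℕ.≤-refl

  orbit-≤-∸ : ∀ x j → orbit x j ≤ x ∸ j
  orbit-≤-∸ x zero    = ℕ.≤-refl
  orbit-≤-∸ x (suc j) = begin
    orbit x (suc j)   ≤⟨ orbit-step-≤ x j ⟩
    pred (orbit x j)  ≤⟨ ℕ.pred-mono-≤ (orbit-≤-∸ x j) ⟩
    pred (x ∸ j)      ≡⟨ ℕ.pred[m∸n]≡m∸[1+n] x j ⟩
    x ∸ suc j         ∎

  orbit-vanishes : ∀ x → orbit x x ≡ 0
  orbit-vanishes x = ℕ.n≤0⇒n≡0 (ℕ.≤-trans (orbit-≤-∸ x x) (ℕ.≤-reflexive (ℕ.n∸n≡0 x)))

  search-minimal : ∀ p s k {j} → s ≤ j → j < search p s k → p j ≡ false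
  search-minimal p s zero    s≤j j<s = ⊥-elim (ℕ.<⇒≱ j<s s≤j)
  search-minimal p s (suc k) s≤j j<r with p s in ps
  ... | true  = ⊥-elim (ℕ.<⇒≱ j<r s≤j)
  ... | false with ℕ.m≤n⇒m<n∨m≡n s≤j
  ...   | inj₁ s<j  = search-minimal p (suc s) k s<j j<r
  ...   | inj₂ refl = ps

  search-found : ∀ p s k → p (search p s k) ≡ true ⊎ search p s k ≡ s + k
  search-found p s zero    = inj₂ (sym (ℕ.+-identityʳ s))
  search-found p s (suc k) with p s in ps
  ... | true  = inj₁ ps
  ... | false with search-found p (suc s) k
  ...   | inj₁ found = inj₁ found
  ...   | inj₂ end   = inj₂ (trans end (sym (ℕ.+-suc s k)))

  orbit-firstBelow-≤ : ∀ x M → orbit x (firstBelow x M) ≤ M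
  orbit-firstBelow-≤ x M with search-found (λ j → orbit x j ≤ᵇ M) 0 x
  ... | inj₁ found = ℕ.≤ᵇ⇒≤ _ M (subst T (sym found) tt)
  ... | inj₂ end   = subst (λ j → orbit x j ≤ M) (sym end) (subst (_≤ M) (sym (orbit-vanishes x)) z≤n)

  <firstBelow⇒<orbit : ∀ x M {j} → j < firstBelow x M → M < orbit x j
  <firstBelow⇒<orbit x M {j} j<first = ℕ.≰⇒> λ orbit≤M →
    subst T (search-minimal (λ j → orbit x j ≤ᵇ M) 0 x z≤n j<first) (ℕ.≤⇒≤ᵇ orbit≤M)

  window-≤2N : ∀ x N i → orbit x (jPlus x N + i) ≤ 2 * N
  window-≤2N x N i = ℕ.≤-trans (orbit-antitone x (ℕ.m≤m+n (jPlus x N) i)) (orbit-firstBelow-≤ x (2 * N))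

  window->N : ∀ x N {i} → i < V x N → N < orbit x (jPlus x N + i)
  window->N x N {i} i<V = <firstBelow⇒<orbit x N (begin-strict
    jPlus x N + i      <⟨ ℕ.+-monoʳ-< (jPlus x N) i<V ⟩
    jPlus x N + V x N  ≡⟨ ℕ.m+[n∸m]≡n jPlus≤jMinus ⟩
    jMinus x N         ∎)
    where
    jPlus≤jMinus : jPlus x N ≤ jMinus x N
    jPlus≤jMinus = ℕ.<⇒≤ (ℕ.m∸n≢0⇒n<m (ℕ.m<n⇒n≢0 i<V))

module Window (x N : ℕ) where
  open ∑ℕ
  open Counting
  open SmallDivisors
  open Orbit using (window-≤2N; window->N)
  open import Data.List.Properties using (map-∘)
  open import Data.Nat using (NonZero)
  open import Data.Nat.Divisibility using (_∣?_)
  open import Data.Nat.ListAction using (sum)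
  open import Defs using (τ; orbit; jPlus; V; countDiv; tauSum)
  open ℕ.≤-Reasoning

  M : ℕ
  M = 2 * N

  windowTerm : ℕ → ℕ
  windowTerm i = orbit x (jPlus x N + i)

  countDiv≡∑ : ∀ d → countDiv x N d ≡ ∑[ i < V x N ] 𝟙 (d ∣? windowTerm i)
  countDiv≡∑ d = length-filter-map-upTo (λ j → d ∣? orbit x j) (jPlus x N +_) (V x N)

  tauSum≡∑ : tauSum x N ≡ ∑[ i < V x N ] τ (windowTerm i)
  tauSum≡∑ = trans (cong sum (sym (map-∘ (upTo (V x N))))) (foldr-map-upTo (τ ∘′ windowTerm) (V x N))

  smallDivisorHits : ℕ
  smallDivisorHits = ∑[ e < M ] when (small? M e) (countDiv x N (suc e))

  smallDivisorHits≡∑ : smallDivisorHits ≡ ∑[ i < V x N ] smallDivisorCount M (windowTerm i)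
  smallDivisorHits≡∑ = begin-equality
    ∑[ e < M ] when (small? M e) (countDiv x N (suc e))
      ≡⟨ ∑-cong M (λ {e} _ → cong (when (small? M e)) (countDiv≡∑ (suc e))) ⟩
    ∑[ e < M ] when (small? M e) (∑[ i < V x N ] 𝟙 (suc e ∣? windowTerm i))
      ≡⟨ ∑-cong M (λ {e} _ → when-∑ (small? M e) _ (V x N)) ⟩
    ∑[ e < M ] ∑[ i < V x N ] when (small? M e) (𝟙 (suc e ∣? windowTerm i))
      ≡⟨ ∑-comm _ M (V x N) ⟩
    ∑[ i < V x N ] smallDivisorCount M (windowTerm i)
      ∎

  private
    windowTerm-bounds : ∀ {i} → i < V x N → NonZero (windowTerm i) × windowTerm i ≤ M
    windowTerm-bounds {i} i<V = ℕ.>-nonZero (ℕ.≤-trans ℕ.z<s (window->N x N i<V)) , window-≤2N x N i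

  smallDivisorHits≤tauSum : smallDivisorHits ≤ tauSum x N
  smallDivisorHits≤tauSum = begin
    smallDivisorHits                                    ≡⟨ smallDivisorHits≡∑ ⟩
    ∑[ i < V x N ] smallDivisorCount M (windowTerm i)   ≤⟨ ∑-mono-≤ (V x N) S≤τ ⟩
    ∑[ i < V x N ] τ (windowTerm i)                     ≡⟨ tauSum≡∑ ⟨
    tauSum x N                                          ∎
    where
    S≤τ : ∀ {i} → i < V x N → smallDivisorCount M (windowTerm i) ≤ τ (windowTerm i)
    S≤τ i<V with windowTerm-bounds i<V
    ... | nonZero , ≤M = smallDivisorCount≤τ {{nonZero}} ≤M

  tauSum≤2*smallDivisorHits : tauSum x N ≤ smallDivisorHits + smallDivisorHits
  tauSum≤2*smallDivisorHits = begin
    tauSum x N                                         ≡⟨ tauSum≡∑ ⟩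
    ∑[ i < V x N ] τ (windowTerm i)                    ≤⟨ ∑-mono-≤ (V x N) τ≤2S ⟩
    ∑[ i < V x N ] S i + S i                           ≡⟨ ∑-distrib-∙ S S (V x N) ⟩
    (∑[ i < V x N ] S i) + (∑[ i < V x N ] S i)        ≡⟨ cong₂ _+_ smallDivisorHits≡∑ smallDivisorHits≡∑ ⟨
    smallDivisorHits + smallDivisorHits                ∎
    where
    S : ℕ → ℕ
    S i = smallDivisorCount M (windowTerm i)
    τ≤2S : ∀ {i} → i < V x N → τ (windowTerm i) ≤ S i + S i
    τ≤2S i<V with windowTerm-bounds i<V
    ... | nonZero , ≤M = τ≤2*smallDivisorCount {{nonZero}} ≤M

module Rationals where
  open import Algebra.Properties.AbelianGroup ℚ.+-0-abelianGroup
    using (xyx⁻¹≈y; ⁻¹-anti-homo‿-; ⁻¹-involutive)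
  open import Data.Integer as ℤ using (+_; +≤+)
  import Data.Integer.Properties as ℤ
  open import Data.Rational as ℚ using (ℚ; _/_; toℚᵘ)
  open import Data.Rational.Unnormalised as ℚᵘ using (mkℚᵘ; *≡*; *≤*)
  import Data.Rational.Unnormalised.Properties as ℚᵘ
  open import Data.Sum using (inj₁; inj₂)

  fromℕ : ℕ → ℚ
  fromℕ n = + n / 1

  private
    toℚᵘ-+/ : ∀ n k → toℚᵘ (+ n / suc k) ℚᵘ.≃ mkℚᵘ (+ n) k
    toℚᵘ-+/ n k = ℚ.toℚᵘ-fromℚᵘ (mkℚᵘ (+ n) k)

    mkℚᵘ-≤ : ∀ m n k l → m * suc l ≤ n * suc k → mkℚᵘ (+ m) k ℚᵘ.≤ mkℚᵘ (+ n) l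
    mkℚᵘ-≤ m n k l h = *≤* (subst₂ ℤ._≤_ (ℤ.pos-* m (suc l)) (ℤ.pos-* n (suc k)) (+≤+ h))

    mkℚᵘ-≤⁻¹ : ∀ m n k l → mkℚᵘ (+ m) k ℚᵘ.≤ mkℚᵘ (+ n) l → m * suc l ≤ n * suc k
    mkℚᵘ-≤⁻¹ m n k l (*≤* h) with subst₂ ℤ._≤_ (sym (ℤ.pos-* m (suc l))) (sym (ℤ.pos-* n (suc k))) h
    ... | +≤+ h′ = h′

  +/-≤ : ∀ m n k l → m * suc l ≤ n * suc k → + m / suc k ℚ.≤ + n / suc l
  +/-≤ m n k l h = ℚ.toℚᵘ-cancel-≤ (begin
    toℚᵘ (+ m / suc k)  ≃⟨ toℚᵘ-+/ m k ⟩
    mkℚᵘ (+ m) k        ≤⟨ mkℚᵘ-≤ m n k l h ⟩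
    mkℚᵘ (+ n) l        ≃⟨ toℚᵘ-+/ n l ⟨
    toℚᵘ (+ n / suc l)  ∎)
    where open ℚᵘ.≤-Reasoning

  +/-≤⁻¹ : ∀ m n k l → + m / suc k ℚ.≤ + n / suc l → m * suc l ≤ n * suc k
  +/-≤⁻¹ m n k l h = mkℚᵘ-≤⁻¹ m n k l (begin
    mkℚᵘ (+ m) k        ≃⟨ toℚᵘ-+/ m k ⟨
    toℚᵘ (+ m / suc k)  ≤⟨ ℚ.toℚᵘ-mono-≤ h ⟩
    toℚᵘ (+ n / suc l)  ≃⟨ toℚᵘ-+/ n l ⟩
    mkℚᵘ (+ n) l        ∎)
    where open ℚᵘ.≤-Reasoning

  fromℕ-mono-≤ : ∀ {m n} → m ≤ n → fromℕ m ℚ.≤ fromℕ n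
  fromℕ-mono-≤ {m} {n} m≤n = +/-≤ m n 0 0 (ℕ.*-monoˡ-≤ 1 m≤n)

  fromℕ-cancel-≤ : ∀ {m n} → fromℕ m ℚ.≤ fromℕ n → m ≤ n
  fromℕ-cancel-≤ {m} {n} h = ℕ.*-cancelʳ-≤ m n 1 (+/-≤⁻¹ m n 0 0 h)

  fromℕ*-mono-≤ : ∀ k {p q} → p ℚ.≤ q → fromℕ k ℚ.* p ℚ.≤ fromℕ k ℚ.* q
  fromℕ*-mono-≤ k = ℚ.*-monoˡ-≤-nonNeg (fromℕ k) {{ℚ.normalize-nonNeg k 1}}

  fromℕ-homo-+ : ∀ m n → fromℕ (m + n) ≡ fromℕ m ℚ.+ fromℕ n
  fromℕ-homo-+ m n = ℚ.toℚᵘ-injective (begin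
    toℚᵘ (fromℕ (m + n))                 ≈⟨ toℚᵘ-+/ (m + n) 0 ⟩
    mkℚᵘ (+ (m + n)) 0                   ≈⟨ *≡* numerators ⟨
    mkℚᵘ (+ m) 0 ℚᵘ.+ mkℚᵘ (+ n) 0       ≈⟨ ℚᵘ.+-cong (toℚᵘ-+/ m 0) (toℚᵘ-+/ n 0) ⟨
    toℚᵘ (fromℕ m) ℚᵘ.+ toℚᵘ (fromℕ n)   ≈⟨ ℚ.toℚᵘ-homo-+ (fromℕ m) (fromℕ n) ⟨
    toℚᵘ (fromℕ m ℚ.+ fromℕ n)           ∎)
    where
    open ℚᵘ.≃-Reasoning
    numerators : (+ m ℤ.* + 1 ℤ.+ + n ℤ.* + 1) ℤ.* + 1 ≡ + (m + n) ℤ.* + 1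
    numerators = cong (ℤ._* + 1)
      (trans (cong₂ ℤ._+_ (ℤ.*-identityʳ (+ m)) (ℤ.*-identityʳ (+ n))) (sym (ℤ.pos-+ m n)))

  fromℕ-*-+/ : ∀ m n k → fromℕ m ℚ.* (+ n / suc k) ≡ + (m * n) / suc k
  fromℕ-*-+/ m n k = ℚ.toℚᵘ-injective (begin
    toℚᵘ (fromℕ m ℚ.* (+ n / suc k))        ≈⟨ ℚ.toℚᵘ-homo-* (fromℕ m) (+ n / suc k) ⟩
    toℚᵘ (fromℕ m) ℚᵘ.* toℚᵘ (+ n / suc k)  ≈⟨ ℚᵘ.*-cong (toℚᵘ-+/ m 0) (toℚᵘ-+/ n k) ⟩
    mkℚᵘ (+ m) 0 ℚᵘ.* mkℚᵘ (+ n) k          ≈⟨ *≡* numerators ⟩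
    mkℚᵘ (+ (m * n)) k                      ≈⟨ toℚᵘ-+/ (m * n) k ⟨
    toℚᵘ (+ (m * n) / suc k)                ∎)
    where
    open ℚᵘ.≃-Reasoning
    numerators : (+ m ℤ.* + n) ℤ.* + suc k ≡ + (m * n) ℤ.* + suc (k + 0)
    numerators = cong₂ ℤ._*_ (sym (ℤ.pos-* m n)) (cong (λ j → + suc j) (sym (ℕ.+-identityʳ k)))

  fromℕ-homo-* : ∀ m n → fromℕ (m * n) ≡ fromℕ m ℚ.* fromℕ n
  fromℕ-homo-* m n = sym (fromℕ-*-+/ m n 0)

  p≤∣p∣ : ∀ p → p ℚ.≤ ℚ.∣ p ∣
  p≤∣p∣ p with ℚ.∣p∣≡p∨∣p∣≡-p p
  ... | inj₁ ∣p∣≡p  = ℚ.≤-reflexive (sym ∣p∣≡p)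
  ... | inj₂ ∣p∣≡-p = ℚ.≤-trans p≤0 (ℚ.0≤∣p∣ p)
    where
    p≤0 : p ℚ.≤ ℚ.0ℚ
    p≤0 = subst (ℚ._≤ ℚ.0ℚ) (⁻¹-involutive p)
                (ℚ.neg-antimono-≤ (subst (ℚ.0ℚ ℚ.≤_) ∣p∣≡-p (ℚ.0≤∣p∣ p)))

  p≤q+∣p-q∣ : ∀ p q → p ℚ.≤ q ℚ.+ ℚ.∣ p ℚ.- q ∣
  p≤q+∣p-q∣ p q = begin
    p                     ≡⟨ xyx⁻¹≈y q p ⟨
    q ℚ.+ p ℚ.- q         ≡⟨ ℚ.+-assoc q p (ℚ.- q) ⟩
    q ℚ.+ (p ℚ.- q)       ≤⟨ ℚ.+-monoʳ-≤ q (p≤∣p∣ (p ℚ.- q)) ⟩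
    q ℚ.+ ℚ.∣ p ℚ.- q ∣   ∎
    where open ℚ.≤-Reasoning

  q≤p+∣p-q∣ : ∀ p q → q ℚ.≤ p ℚ.+ ℚ.∣ p ℚ.- q ∣
  q≤p+∣p-q∣ p q = subst (λ r → q ℚ.≤ p ℚ.+ r) ∣q-p∣≡∣p-q∣ (p≤q+∣p-q∣ q p)
    where
    ∣q-p∣≡∣p-q∣ : ℚ.∣ q ℚ.- p ∣ ≡ ℚ.∣ p ℚ.- q ∣
    ∣q-p∣≡∣p-q∣ = trans (cong ℚ.∣_∣ (sym (⁻¹-anti-homo‿- p q))) (ℚ.∣-p∣≡∣p∣ (p ℚ.- q))

module RationalSums where
  open ∑ℚ
  open Rationals
  open import Data.Integer using (+_)
  open import Data.Nat using (NonZero; _^_)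
  open import Data.Nat.Tactic.RingSolver using (solve-∀)
  open import Data.Rational as ℚ using (ℚ; _/_)

  fromℕ-when : ∀ {P : Set} (P? : Dec P) n → fromℕ (∑ℕ.when P? n) ≡ when P? (fromℕ n)
  fromℕ-when (yes _) n = refl
  fromℕ-when (no _)  n = refl

  fromℕ-∑ : ∀ (f : ℕ → ℕ) n → fromℕ (∑ℕ.∑< n f) ≡ ∑[ i < n ] fromℕ (f i)
  fromℕ-∑ f zero    = refl
  fromℕ-∑ f (suc n) = trans (fromℕ-homo-+ (∑ℕ.∑< n f) (f n)) (cong (ℚ._+ fromℕ (f n)) (fromℕ-∑ f n))

  ∑-*ˡ : ∀ c (f : ℕ → ℚ) n → ∑[ i < n ] c ℚ.* f i ≡ c ℚ.* ∑< n f
  ∑-*ˡ c f zero    = sym (ℚ.*-zeroʳ c)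
  ∑-*ˡ c f (suc n) = trans (cong (ℚ._+ c ℚ.* f n) (∑-*ˡ c f n)) (sym (ℚ.*-distribˡ-+ c (∑< n f) (f n)))

  ∑-const : ∀ n c → ∑[ i < n ] c ≡ fromℕ n ℚ.* c
  ∑-const zero    c = sym (ℚ.*-zeroˡ c)
  ∑-const (suc n) c = begin
    (∑[ i < n ] c) ℚ.+ c               ≡⟨ cong₂ ℚ._+_ (∑-const n c) (sym (ℚ.*-identityˡ c)) ⟩
    fromℕ n ℚ.* c ℚ.+ fromℕ 1 ℚ.* c    ≡⟨ ℚ.*-distribʳ-+ c (fromℕ n) (fromℕ 1) ⟨
    (fromℕ n ℚ.+ fromℕ 1) ℚ.* c        ≡⟨ cong (ℚ._* c) (fromℕ-homo-+ n 1) ⟨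
    fromℕ (n + 1) ℚ.* c                ≡⟨ cong (λ k → fromℕ k ℚ.* c) (ℕ.+-comm n 1) ⟩
    fromℕ (suc n) ℚ.* c                ∎
    where open ≡-Reasoning

  harmonic : ℕ → ℚ
  harmonic n = ∑[ e < n ] + 1 / suc e

  ∑-+/≡fromℕ*harmonic : ∀ V n → ∑[ e < n ] + V / suc e ≡ fromℕ V ℚ.* harmonic n
  ∑-+/≡fromℕ*harmonic V n = trans (∑-cong n (λ {e} _ → sym (V*1/e≡V/e e))) (∑-*ˡ (fromℕ V) _ n)
    where
    V*1/e≡V/e : ∀ e → fromℕ V ℚ.* (+ 1 / suc e) ≡ + V / suc e
    V*1/e≡V/e e = trans (fromℕ-*-+/ V 1 e) (cong (λ k → + k / suc e) (ℕ.*-identityʳ V))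

  private
    harmonicBlock : ℕ → ℚ
    harmonicBlock P = ∑[ i < P ] + 1 / suc (P + i)

    harmonicBlock≤1 : ∀ P .{{_ : NonZero P}} → harmonicBlock P ℚ.≤ fromℕ 1
    harmonicBlock≤1 P@(suc p) = begin
      ∑[ i < P ] + 1 / suc (P + i)  ≤⟨ ∑-mono-≤ P ≤1/P ⟩
      ∑[ i < P ] + 1 / P            ≡⟨ ∑-const P (+ 1 / P) ⟩
      fromℕ P ℚ.* (+ 1 / P)         ≡⟨ fromℕ-*-+/ P 1 p ⟩
      + (P * 1) / P                 ≤⟨ +/-≤ (P * 1) 1 p 0 (ℕ.≤-reflexive (q*1*1≡1*q P)) ⟩
      fromℕ 1                       ∎
      where
      open ℚ.≤-Reasoning
      q*1*1≡1*q : ∀ q → q * 1 * 1 ≡ 1 * q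
      q*1*1≡1*q = solve-∀
      ≤1/P : ∀ {i} → i < P → + 1 / suc (P + i) ℚ.≤ + 1 / P
      ≤1/P {i} _ = +/-≤ 1 1 (P + i) p (ℕ.*-monoʳ-≤ 1 (ℕ.m≤n⇒m≤1+n (ℕ.m≤m+n P i)))

    1≤2*harmonicBlock : ∀ P .{{_ : NonZero P}} → fromℕ 1 ℚ.≤ fromℕ 2 ℚ.* harmonicBlock P
    1≤2*harmonicBlock P@(suc p) = begin
      fromℕ 1                                    ≤⟨ +/-≤ 1 (2 * P) 0 (p + P) (ℕ.≤-reflexive (1*[q+q]≡2*q*1 P)) ⟩
      + (2 * P) / (P + P)                        ≡⟨ cong (λ k → + (2 * k) / (P + P)) (ℕ.*-identityʳ P) ⟨
      + (2 * (P * 1)) / (P + P)                  ≡⟨ fromℕ-*-+/ 2 (P * 1) (p + P) ⟨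
      fromℕ 2 ℚ.* (+ (P * 1) / (P + P))          ≡⟨ cong (fromℕ 2 ℚ.*_) (fromℕ-*-+/ P 1 (p + P)) ⟨
      fromℕ 2 ℚ.* (fromℕ P ℚ.* (+ 1 / (P + P)))  ≡⟨ cong (fromℕ 2 ℚ.*_) (∑-const P (+ 1 / (P + P))) ⟨
      fromℕ 2 ℚ.* (∑[ i < P ] + 1 / (P + P))     ≤⟨ fromℕ*-mono-≤ 2 (∑-mono-≤ P 1/2P≤) ⟩
      fromℕ 2 ℚ.* harmonicBlock P                ∎
      where
      open ℚ.≤-Reasoning
      1*[q+q]≡2*q*1 : ∀ q → 1 * (q + q) ≡ 2 * q * 1
      1*[q+q]≡2*q*1 = solve-∀
      1/2P≤ : ∀ {i} → i < P → + 1 / (P + P) ℚ.≤ + 1 / suc (P + i)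
      1/2P≤ {i} i<P = +/-≤ 1 1 (p + P) (P + i) (ℕ.*-monoʳ-≤ 1 (ℕ.+-monoʳ-< P i<P))

    harmonic-2^suc : ∀ m → harmonic (2 ^ suc m) ≡ harmonic (2 ^ m) ℚ.+ harmonicBlock (2 ^ m)
    harmonic-2^suc m = trans (cong harmonic (cong (λ k → 2 ^ m + k) (ℕ.+-identityʳ (2 ^ m))))
                             (∑-split (λ e → + 1 / suc e) (2 ^ m) (2 ^ m))

  harmonic-2^-≤ : ∀ m → harmonic (2 ^ m) ℚ.≤ fromℕ (suc m)
  harmonic-2^-≤ zero    = ℚ.≤-reflexive (ℚ.+-identityˡ (fromℕ 1))
  harmonic-2^-≤ (suc m) = begin
    harmonic (2 ^ suc m)                        ≡⟨ harmonic-2^suc m ⟩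
    harmonic (2 ^ m) ℚ.+ harmonicBlock (2 ^ m)
      ≤⟨ ℚ.+-mono-≤ (harmonic-2^-≤ m) (harmonicBlock≤1 (2 ^ m) {{ℕ.m^n≢0 2 m}}) ⟩
    fromℕ (suc m) ℚ.+ fromℕ 1                   ≡⟨ ℚ.+-comm (fromℕ (suc m)) (fromℕ 1) ⟩
    fromℕ 1 ℚ.+ fromℕ (suc m)                   ≡⟨ fromℕ-homo-+ 1 (suc m) ⟨
    fromℕ (suc (suc m))                         ∎
    where open ℚ.≤-Reasoning

  2+m≤2*harmonic-2^ : ∀ m → fromℕ (2 + m) ℚ.≤ fromℕ 2 ℚ.* harmonic (2 ^ m)
  2+m≤2*harmonic-2^ zero    = ℚ.≤-reflexive (cong (fromℕ 2 ℚ.*_) (sym (ℚ.+-identityˡ (fromℕ 1))))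
  2+m≤2*harmonic-2^ (suc m) = begin
    fromℕ (2 + suc m)                                     ≡⟨ cong fromℕ (ℕ.+-comm 1 (2 + m)) ⟩
    fromℕ (2 + m + 1)                                     ≡⟨ fromℕ-homo-+ (2 + m) 1 ⟩
    fromℕ (2 + m) ℚ.+ fromℕ 1
      ≤⟨ ℚ.+-mono-≤ (2+m≤2*harmonic-2^ m) (1≤2*harmonicBlock (2 ^ m) {{ℕ.m^n≢0 2 m}}) ⟩
    fromℕ 2 ℚ.* harmonic (2 ^ m) ℚ.+ fromℕ 2 ℚ.* block
      ≡⟨ ℚ.*-distribˡ-+ (fromℕ 2) (harmonic (2 ^ m)) block ⟨
    fromℕ 2 ℚ.* (harmonic (2 ^ m) ℚ.+ block)              ≡⟨ cong (fromℕ 2 ℚ.*_) (harmonic-2^suc m) ⟨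
    fromℕ 2 ℚ.* harmonic (2 ^ suc m)                      ∎
    where
    open ℚ.≤-Reasoning
    block : ℚ
    block = harmonicBlock (2 ^ m)

module Log₂ where
  open import Data.Nat using (NonZero; _^_; ⌊_/2⌋; ⌈_/2⌉)
  open import Data.Nat.Induction using (<-wellFounded)
  open import Data.Nat.Logarithm using (⌊log₂_⌋; ⌊log₂⌋-mono-≤; ⌊log₂[2^n]⌋≡n)
  open import Data.Nat.Logarithm.Core using (⌊log2⌋)
  open import Data.Nat.Tactic.RingSolver using (solve-∀)
  open import Induction.WellFounded using (Acc; acc)
  open ℕ.≤-Reasoning

  ⌊n/2⌋+⌊n/2⌋≤n : ∀ n → ⌊ n /2⌋ + ⌊ n /2⌋ ≤ n
  ⌊n/2⌋+⌊n/2⌋≤n n = begin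
    ⌊ n /2⌋ + ⌊ n /2⌋  ≤⟨ ℕ.+-monoʳ-≤ ⌊ n /2⌋ (ℕ.⌊n/2⌋≤⌈n/2⌉ n) ⟩
    ⌊ n /2⌋ + ⌈ n /2⌉  ≡⟨ ℕ.⌊n/2⌋+⌈n/2⌉≡n n ⟩
    n                  ∎

  n≤1+⌊n/2⌋+⌊n/2⌋ : ∀ n → n ≤ suc (⌊ n /2⌋ + ⌊ n /2⌋)
  n≤1+⌊n/2⌋+⌊n/2⌋ zero          = z≤n
  n≤1+⌊n/2⌋+⌊n/2⌋ (suc zero)    = ℕ.≤-refl
  n≤1+⌊n/2⌋+⌊n/2⌋ (suc (suc n)) = s≤s (begin
    suc n                          ≤⟨ s≤s (n≤1+⌊n/2⌋+⌊n/2⌋ n) ⟩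
    suc (suc (⌊ n /2⌋ + ⌊ n /2⌋))  ≡⟨ cong suc (ℕ.+-suc ⌊ n /2⌋ ⌊ n /2⌋) ⟨
    suc (⌊ n /2⌋ + suc ⌊ n /2⌋)    ∎)

  2^⌊log₂n⌋≤n : ∀ n .{{_ : NonZero n}} → 2 ^ ⌊log₂ n ⌋ ≤ n
  2^⌊log₂n⌋≤n n = bound n (<-wellFounded n)
    where
    2*[1+h]≡2+h+h : ∀ h → 2 * suc h ≡ suc (suc (h + h))
    2*[1+h]≡2+h+h = solve-∀

    bound : ∀ n (rec : Acc _<_ n) .{{_ : NonZero n}} → 2 ^ ⌊log2⌋ n rec ≤ n
    bound (suc zero)    _        = ℕ.≤-refl
    bound (suc (suc n)) (acc rs) = begin
      2 * 2 ^ ⌊log2⌋ (suc ⌊ n /2⌋) _  ≤⟨ ℕ.*-monoʳ-≤ 2 (bound (suc ⌊ n /2⌋) _) ⟩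
      2 * suc ⌊ n /2⌋                 ≡⟨ 2*[1+h]≡2+h+h ⌊ n /2⌋ ⟩
      suc (suc (⌊ n /2⌋ + ⌊ n /2⌋))   ≤⟨ s≤s (s≤s (⌊n/2⌋+⌊n/2⌋≤n n)) ⟩
      suc (suc n)                     ∎

  n<2^[1+⌊log₂n⌋] : ∀ n → n < 2 ^ suc ⌊log₂ n ⌋
  n<2^[1+⌊log₂n⌋] n = ℕ.≰⇒> λ 2^[1+L]≤n →
    ℕ.n≮n ⌊log₂ n ⌋ (subst (_≤ ⌊log₂ n ⌋) (⌊log₂[2^n]⌋≡n (suc ⌊log₂ n ⌋)) (⌊log₂⌋-mono-≤ 2^[1+L]≤n))

module Comparison (x N : ℕ) where
  open ∑ℚ
  open Rationals
  open RationalSums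
  open Log₂
  open SmallDivisors using (small?)
  open Window x N using (M; smallDivisorHits; smallDivisorHits≤tauSum; tauSum≤2*smallDivisorHits)
  open import Algebra.Bundles using (CommutativeMonoid)
  open import Algebra.Properties.CommutativeSemigroup
    (CommutativeMonoid.commutativeSemigroup ℚ.*-1-commutativeMonoid) using (x∙yz≈y∙xz)
  open import Data.Integer using (+_)
  open import Data.Nat using (NonZero; _^_; ⌊_/2⌋)
  open import Data.Nat.Logarithm using (⌊log₂_⌋; ⌊log₂⌋-mono-≤)
  open import Data.Nat.Tactic.RingSolver using (solve-∀)
  open import Data.Rational as ℚ using (ℚ; _/_)
  open import Defs using (V; countDiv; tauSum; mixingError)

  ∑small : (ℕ → ℚ) → ℚ
  ∑small f = ∑[ e < M ] when (small? M e) (f e)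

  ∑small-≤-+ : ∀ {f g h : ℕ → ℚ} → (∀ e → f e ℚ.≤ g e ℚ.+ h e) → ∑small f ℚ.≤ ∑small g ℚ.+ ∑small h
  ∑small-≤-+ {f} {g} {h} f≤g+h = begin
    ∑small f                                            ≤⟨ ∑-mono-≤ M (λ {e} _ → when-mono-≤ (small? M e) (f≤g+h e)) ⟩
    ∑[ e < M ] when (small? M e) (g e ℚ.+ h e)          ≡⟨ ∑-cong M (λ {e} _ → when-∙ (small? M e) (g e) (h e)) ⟩
    ∑[ e < M ] when (small? M e) (g e) ℚ.+ when (small? M e) (h e)
                                                        ≡⟨ ∑-distrib-∙ _ _ M ⟩
    ∑small g ℚ.+ ∑small h                               ∎
    where open ℚ.≤-Reasoning

  observed expected deviation : ℕ → ℚ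
  observed e  = fromℕ (countDiv x N (suc e))
  expected e  = + V x N / suc e
  deviation e = ℚ.∣ observed e ℚ.- expected e ∣

  fromℕ-smallDivisorHits : fromℕ smallDivisorHits ≡ ∑small observed
  fromℕ-smallDivisorHits = trans (fromℕ-∑ _ M) (∑-cong M (λ {e} _ → fromℕ-when (small? M e) _))

  mixingError≡∑small : mixingError x N ≡ ∑small deviation
  mixingError≡∑small = trans (foldr-map-filter (small? M) deviation (upTo M)) (foldr-map-upTo _ M)

  hits≤expected+error : fromℕ smallDivisorHits ℚ.≤ ∑small expected ℚ.+ mixingError x N
  hits≤expected+error =
    subst₂ (λ a b → a ℚ.≤ ∑small expected ℚ.+ b) (sym fromℕ-smallDivisorHits) (sym mixingError≡∑small)
      (∑small-≤-+ (λ e → p≤q+∣p-q∣ (observed e) (expected e)))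

  expected≤hits+error : ∑small expected ℚ.≤ fromℕ smallDivisorHits ℚ.+ mixingError x N
  expected≤hits+error =
    subst₂ (λ a b → ∑small expected ℚ.≤ a ℚ.+ b) (sym fromℕ-smallDivisorHits) (sym mixingError≡∑small)
      (∑small-≤-+ (λ e → q≤p+∣p-q∣ (observed e) (expected e)))

  private
    expected-nonNeg : ∀ e → ℚ.0ℚ ℚ.≤ expected e
    expected-nonNeg e = +/-≤ 0 (V x N) 0 e z≤n

  ∑small-expected-≤ : ∀ K → M ≤ 2 ^ K → ∑small expected ℚ.≤ fromℕ (V x N * suc K)
  ∑small-expected-≤ K M≤2^K = begin
    ∑small expected                     ≤⟨ ∑-mono-≤ M (λ {e} _ → when-≤ (small? M e) (expected-nonNeg e)) ⟩
    ∑[ e < M ] expected e               ≤⟨ ∑-prefix-≤ M≤2^K expected-nonNeg ⟩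
    ∑[ e < 2 ^ K ] expected e           ≡⟨ ∑-+/≡fromℕ*harmonic (V x N) (2 ^ K) ⟩
    fromℕ (V x N) ℚ.* harmonic (2 ^ K)  ≤⟨ fromℕ*-mono-≤ (V x N) (harmonic-2^-≤ K) ⟩
    fromℕ (V x N) ℚ.* fromℕ (suc K)     ≡⟨ fromℕ-homo-* (V x N) (suc K) ⟨
    fromℕ (V x N * suc K)               ∎
    where open ℚ.≤-Reasoning

  ∑small-expected-≥ : ∀ m → 2 ^ m * 2 ^ m ≤ M →
                      fromℕ (V x N * (2 + m)) ℚ.≤ fromℕ 2 ℚ.* ∑small expected
  ∑small-expected-≥ m 4^m≤M = begin
    fromℕ (V x N * (2 + m))                                 ≡⟨ fromℕ-homo-* (V x N) (2 + m) ⟩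
    fromℕ (V x N) ℚ.* fromℕ (2 + m)                         ≤⟨ fromℕ*-mono-≤ (V x N) (2+m≤2*harmonic-2^ m) ⟩
    fromℕ (V x N) ℚ.* (fromℕ 2 ℚ.* harmonic (2 ^ m))        ≡⟨ x∙yz≈y∙xz (fromℕ (V x N)) (fromℕ 2) (harmonic (2 ^ m)) ⟩
    fromℕ 2 ℚ.* (fromℕ (V x N) ℚ.* harmonic (2 ^ m))        ≡⟨ cong (fromℕ 2 ℚ.*_) ∑[<2^m]≡ ⟨
    fromℕ 2 ℚ.* (∑[ e < 2 ^ m ] when (small? M e) (expected e))
      ≤⟨ fromℕ*-mono-≤ 2 (∑-prefix-≤ 2^m≤M (λ e → when-nonNeg (small? M e) (expected-nonNeg e))) ⟩
    fromℕ 2 ℚ.* ∑small expected                             ∎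
    where
    open ℚ.≤-Reasoning
    2^m≤M : 2 ^ m ≤ M
    2^m≤M = ℕ.≤-trans (ℕ.m≤m*n (2 ^ m) (2 ^ m) {{ℕ.m^n≢0 2 m}}) 4^m≤M
    small : ∀ {e} → e < 2 ^ m → suc e * suc e ≤ M
    small e<2^m = ℕ.≤-trans (ℕ.*-mono-≤ e<2^m e<2^m) 4^m≤M
    ∑[<2^m]≡ : ∑[ e < 2 ^ m ] when (small? M e) (expected e) ≡ fromℕ (V x N) ℚ.* harmonic (2 ^ m)
    ∑[<2^m]≡ = trans (∑-cong (2 ^ m) (λ {e} e<2^m → when-true (small? M e) (small e<2^m)))
                     (∑-+/≡fromℕ*harmonic (V x N) (2 ^ m))

  private
    L T A : ℕ
    L = ⌊log₂ N ⌋
    T = V x N * L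
    A = smallDivisorHits

    E : ℚ
    E = mixingError x N

    m : ℕ
    m = ⌊ L /2⌋

    4^m≤M : .{{_ : NonZero N}} → 2 ^ m * 2 ^ m ≤ M
    4^m≤M = begin
      2 ^ m * 2 ^ m  ≡⟨ ℕ.^-distribˡ-+-* 2 m m ⟨
      2 ^ (m + m)    ≤⟨ ℕ.^-monoʳ-≤ 2 (⌊n/2⌋+⌊n/2⌋≤n L) ⟩
      2 ^ L          ≤⟨ 2^⌊log₂n⌋≤n N ⟩
      N              ≤⟨ ℕ.m≤m+n N (N + 0) ⟩
      M              ∎
      where open ℕ.≤-Reasoning

    2T≤4V[2+m] : T + T ≤ 4 * (V x N * (2 + m))
    2T≤4V[2+m] = begin
      T + T                                                  ≤⟨ ℕ.+-mono-≤ T≤ T≤ ⟩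
      V x N * suc (m + m) + V x N * suc (m + m)              ≤⟨ ℕ.m≤m+n _ (6 * V x N) ⟩
      V x N * suc (m + m) + V x N * suc (m + m) + 6 * V x N  ≡⟨ v[1+2m]+v[1+2m]+6v≡4v[2+m] (V x N) m ⟩
      4 * (V x N * (2 + m))                                  ∎
      where
      open ℕ.≤-Reasoning
      T≤ : T ≤ V x N * suc (m + m)
      T≤ = ℕ.*-monoʳ-≤ (V x N) (n≤1+⌊n/2⌋+⌊n/2⌋ L)
      v[1+2m]+v[1+2m]+6v≡4v[2+m] : ∀ v m → v * suc (m + m) + v * suc (m + m) + 6 * v ≡ 4 * (v * (2 + m))
      v[1+2m]+v[1+2m]+6v≡4v[2+m] = solve-∀

  -- T ≤ 4 ∑small expected ≤ 4 (A + E), so the hypothesis 8 E ≤ T leaves T ≤ 8 A.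
  V*log≤8*tauSum : .{{_ : NonZero N}} → E ℚ.* fromℕ 8 ℚ.≤ fromℕ T → T ≤ 8 * tauSum x N
  V*log≤8*tauSum 8E≤T = ℕ.≤-trans (ℕ.+-cancelʳ-≤ T T (8 * A) (fromℕ-cancel-≤ 2T≤8A+T))
                                  (ℕ.*-monoʳ-≤ 8 smallDivisorHits≤tauSum)
    where
    2T≤8A+T : fromℕ (T + T) ℚ.≤ fromℕ (8 * A + T)
    2T≤8A+T = begin
      fromℕ (T + T)                               ≤⟨ fromℕ-mono-≤ 2T≤4V[2+m] ⟩
      fromℕ (4 * (V x N * (2 + m)))               ≡⟨ fromℕ-homo-* 4 (V x N * (2 + m)) ⟩
      fromℕ 4 ℚ.* fromℕ (V x N * (2 + m))         ≤⟨ fromℕ*-mono-≤ 4 (∑small-expected-≥ m 4^m≤M) ⟩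
      fromℕ 4 ℚ.* (fromℕ 2 ℚ.* ∑small expected)   ≡⟨ ℚ.*-assoc (fromℕ 4) (fromℕ 2) (∑small expected) ⟨
      fromℕ 4 ℚ.* fromℕ 2 ℚ.* ∑small expected     ≡⟨ cong (ℚ._* ∑small expected) (fromℕ-homo-* 4 2) ⟨
      fromℕ 8 ℚ.* ∑small expected                 ≤⟨ fromℕ*-mono-≤ 8 expected≤hits+error ⟩
      fromℕ 8 ℚ.* (fromℕ A ℚ.+ E)                 ≡⟨ ℚ.*-distribˡ-+ (fromℕ 8) (fromℕ A) E ⟩
      fromℕ 8 ℚ.* fromℕ A ℚ.+ fromℕ 8 ℚ.* E       ≤⟨ ℚ.+-monoʳ-≤ (fromℕ 8 ℚ.* fromℕ A) 8E≤T′ ⟩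
      fromℕ 8 ℚ.* fromℕ A ℚ.+ fromℕ T             ≡⟨ cong (ℚ._+ fromℕ T) (fromℕ-homo-* 8 A) ⟨
      fromℕ (8 * A) ℚ.+ fromℕ T                   ≡⟨ fromℕ-homo-+ (8 * A) T ⟨
      fromℕ (8 * A + T)                           ∎
      where
      open ℚ.≤-Reasoning
      8E≤T′ : fromℕ 8 ℚ.* E ℚ.≤ fromℕ T
      8E≤T′ = subst (ℚ._≤ fromℕ T) (ℚ.*-comm E (fromℕ 8)) 8E≤T

  private
    hits≤V[3+L]+T : E ℚ.* fromℕ 1 ℚ.≤ fromℕ T → fromℕ A ℚ.≤ fromℕ (V x N * (3 + L) + T)
    hits≤V[3+L]+T E*1≤T = begin
      fromℕ A                              ≤⟨ hits≤expected+error ⟩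
      ∑small expected ℚ.+ E                ≤⟨ ℚ.+-mono-≤ (∑small-expected-≤ (2 + L) M≤2^[2+L]) E≤T ⟩
      fromℕ (V x N * (3 + L)) ℚ.+ fromℕ T  ≡⟨ fromℕ-homo-+ (V x N * (3 + L)) T ⟨
      fromℕ (V x N * (3 + L) + T)          ∎
      where
      open ℚ.≤-Reasoning
      M≤2^[2+L] : M ≤ 2 ^ (2 + L)
      M≤2^[2+L] = ℕ.*-monoʳ-≤ 2 (ℕ.<⇒≤ (n<2^[1+⌊log₂n⌋] N))
      E≤T : E ℚ.≤ fromℕ T
      E≤T = subst (ℚ._≤ fromℕ T) (ℚ.*-identityʳ E) E*1≤T

  -- tauSum ≤ 2 A and A ≤ ∑small expected + E ≤ 4 T + T, using log₂ N ≥ 1.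
  tauSum≤10*V*log : 2 ≤ N → E ℚ.* fromℕ 1 ℚ.≤ fromℕ T → tauSum x N ≤ 10 * T
  tauSum≤10*V*log 2≤N E*1≤T = begin
    tauSum x N     ≤⟨ tauSum≤2*smallDivisorHits ⟩
    A + A          ≤⟨ ℕ.+-mono-≤ A≤5T A≤5T ⟩
    5 * T + 5 * T  ≡⟨ 5t+5t≡10t T ⟩
    10 * T         ∎
    where
    open ℕ.≤-Reasoning
    5t+5t≡10t : ∀ t → 5 * t + 5 * t ≡ 10 * t
    5t+5t≡10t = solve-∀
    v[3l+l]+vl≡5vl : ∀ v l → v * (3 * l + l) + v * l ≡ 5 * (v * l)
    v[3l+l]+vl≡5vl = solve-∀
    3≤3L : 3 ≤ 3 * L
    3≤3L = ℕ.*-monoʳ-≤ 3 (⌊log₂⌋-mono-≤ 2≤N)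
    A≤5T : A ≤ 5 * T
    A≤5T = begin
      A                        ≤⟨ fromℕ-cancel-≤ (hits≤V[3+L]+T E*1≤T) ⟩
      V x N * (3 + L) + T      ≤⟨ ℕ.+-monoˡ-≤ T (ℕ.*-monoʳ-≤ (V x N) (ℕ.+-monoˡ-≤ L 3≤3L)) ⟩
      V x N * (3 * L + L) + T  ≡⟨ v[3l+l]+vl≡5vl (V x N) L ⟩
      5 * T                    ∎

open import Defs
open import Data.Nat using (ℕ; suc; _+_; _*_; _≤_; _≥_)
open import Data.Nat.Logarithm using (⌊log₂_⌋)
open import Data.Integer using (+_)
open import Data.Rational using (ℚ; _/_; _*_; _≤_)
open import Data.Product using (Σ; _×_)

mainTheorem4 : (X : ℕ → ℕ)
    → ((k : ℕ) → Σ ℕ (λ N₀ → (N : ℕ) → N ≥ N₀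
         → mixingError (X N) N Data.Rational.* ((+ suc k) / 1)
             Data.Rational.≤ (+ (V (X N) N Data.Nat.* ⌊log₂ N ⌋)) / 1))
    → Σ ℕ (λ c → Σ ℕ (λ C → Σ ℕ (λ N₀ → (N : ℕ) → N ≥ N₀
         → (V (X N) N Data.Nat.* ⌊log₂ N ⌋ Data.Nat.≤ suc c Data.Nat.* tauSum (X N) N)
         × (tauSum (X N) N Data.Nat.≤ C Data.Nat.* (V (X N) N Data.Nat.* ⌊log₂ N ⌋)))))
mainTheorem4 X mixing = 7 , 10 , N₀ , λ N N≥N₀ →
    Comparison.V*log≤8*tauSum (X N) N {{N≢0 N≥N₀}} (proj₂ (mixing 7) N (b≤ N≥N₀))
  , Comparison.tauSum≤10*V*log (X N) N (2≤ N≥N₀) (proj₂ (mixing 0) N (a≤ N≥N₀))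
  where
  open import Data.Nat using (NonZero; _⊔_)
  a b N₀ : ℕ
  a  = proj₁ (mixing 0)
  b  = proj₁ (mixing 7)
  N₀ = a ⊔ b ⊔ 2
  a≤ : ∀ {N} → N₀ ℕ.≤ N → a ℕ.≤ N
  a≤ = ℕ.m⊔n≤o⇒m≤o a b ∘′ ℕ.m⊔n≤o⇒m≤o (a ⊔ b) 2
  b≤ : ∀ {N} → N₀ ℕ.≤ N → b ℕ.≤ N
  b≤ = ℕ.m⊔n≤o⇒n≤o a b ∘′ ℕ.m⊔n≤o⇒m≤o (a ⊔ b) 2
  2≤ : ∀ {N} → N₀ ℕ.≤ N → 2 ℕ.≤ N
  2≤ = ℕ.m⊔n≤o⇒n≤o (a ⊔ b) 2
  N≢0 : ∀ {N} → N₀ ℕ.≤ N → NonZero N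
  N≢0 = ℕ.>-nonZero ∘′ ℕ.≤-trans (s≤s z≤n) ∘′ 2≤
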